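{- Let $\tau\in B_k$ with $|\tau|=12\ldots k$ (i.e. $|\tau_i|=i$ for all $i$, with arbitrary signs). Then $|B_n(\tau)|=|B_n(12\ldots k)|$ and $|SI_n(\tau)|=|SI_n(12\ldots k)|$ for all $n\ge1$.
   Context: $B_n$ is the set of signed permutations of $[n]$, written as words $\pi=\pi_1\cdots\pi_n$ in which each of $1,\dots,n$ appears exactly once, possibly barred (negative). $|\pi|$ is the unsigned word $|\pi_1|\cdots|\pi_n|$. A signed permutation $\pi\in B_n$ contains $\tau\in B_k$ if there are indices $i_1<\dots<i_k$ such that for all $a,b$: $|\pi_{i_a}|<|\pi_{i_b}|$ iff $|\tau_a|<|\tau_b|$, and $\pi_{i_a}$ is positive iff $\tau_a$ is positive; otherwise $\pi$ avoids $\tau$. $M(\tau)$ is the set of elements of $M$ avoiding $\tau$. $SI_n$ is the set of signed involutions in $B_n$ (signed permutations $\pi$, viewed as bijections of $\{\pm1,\dots,\pm n\}$ with $\pi(-i)=-\pi(i)$, satisfying $\pi\circ\pi=\mathrm{id}$). $12\ldots k$ denotes the all-unbarred increasing pattern. -}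

module Defs where

open import Data.Bool using (Bool; true; false; _∧_)
open import Data.Bool.Properties using () renaming (_≟_ to _≟B_)
open import Data.Nat using (ℕ; zero; suc)
open import Data.Fin using (Fin; _<_)
open import Data.Fin.Properties using (all?; _<?_) renaming (_≟_ to _≟F_)
open import Data.Product using (_×_; _,_; proj₁; proj₂)
open import Data.Product.Properties using (≡-dec)
open import Data.List using (List; []; _∷_; [_]; map; _++_; filter; length; concatMap)
open import Data.List.Relation.Unary.Any using (Any)
import Data.List.Relation.Unary.Any as Any
open import Data.Vec using (Vec; []; _∷_; lookup; tabulate; toList)
open import Relation.Binary.PropositionalEquality using (_≡_)
open import Relation.Nullary using (Dec; yes; no; ¬_)
open import Relation.Nullary.Decidable using (_×-dec_; _→-dec_; ¬?)

-- A signed letter: (|x|, sign), values in Fin n (i.e. 0..n-1 encodes 1..n),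
-- sign true = positive (unbarred), false = negative (barred).
Letter : ℕ → Set
Letter n = Fin n × Bool

Word : ℕ → Set
Word n = Vec (Letter n) n

IsSignedPerm : ∀ {n} → Word n → Set
IsSignedPerm {n} w = (i j : Fin n) → proj₁ (lookup w i) ≡ proj₁ (lookup w j) → i ≡ j

isSignedPerm? : ∀ {n} (w : Word n) → Dec (IsSignedPerm w)
isSignedPerm? w = all? λ i → all? λ j → (proj₁ (lookup w i) ≟F proj₁ (lookup w j)) →-dec (i ≟F j)

-- Signed permutation applied to a signed element ±j of {±1..±n}:
-- π(ε·j) = ε·π(j).
sgnMul : Bool → Bool → Bool
sgnMul true  b = b
sgnMul false true = false
sgnMul false false = true

apply : ∀ {n} → Word n → Letter n → Letter n
apply w (j , s) = proj₁ (lookup w j) , sgnMul s (proj₂ (lookup w j))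

-- Signed involution: π ∘ π = id on {±1,…,±n} (element ±(j+1) is (j , sign)).
IsInvolution : ∀ {n} → Word n → Set
IsInvolution {n} w = (j : Fin n) (s : Bool) → apply w (apply w (j , s)) ≡ (j , s)

isInvolution? : ∀ {n} (w : Word n) → Dec (IsInvolution w)
isInvolution? w = all? λ j → ∀B (λ s → ≡-dec _≟F_ _≟B_ (apply w (apply w (j , s))) (j , s))
  where
  ∀B : {P : Bool → Set} → ((b : Bool) → Dec (P b)) → Dec ((b : Bool) → P b)
  ∀B P? with P? true | P? false
  ... | yes p | yes q = yes λ { true → p ; false → q }
  ... | no ¬p | _ = no λ f → ¬p (f true)
  ... | yes _ | no ¬q = no λ f → ¬q (f false)

subseqs : ∀ {A : Set} {n} k → Vec A n → List (Vec A k)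
subseqs zero _ = [ [] ]
subseqs (suc k) [] = []
subseqs (suc k) (x ∷ xs) = map (x ∷_) (subseqs k xs) ++ subseqs (suc k) xs

Matches : ∀ {n k} → Vec (Letter k) k → Vec (Letter n) k → Set
Matches {n} {k} τ u = (a b : Fin k) →
  ((proj₁ (lookup u a) < proj₁ (lookup u b)) → (proj₁ (lookup τ a) < proj₁ (lookup τ b)))
  × ((proj₁ (lookup τ a) < proj₁ (lookup τ b)) → (proj₁ (lookup u a) < proj₁ (lookup u b)))
  × (proj₂ (lookup u a) ≡ proj₂ (lookup τ a))

matches? : ∀ {n k} (τ : Vec (Letter k) k) (u : Vec (Letter n) k) → Dec (Matches τ u)
matches? τ u = all? λ a → all? λ b →
  ((proj₁ (lookup u a) <? proj₁ (lookup u b)) →-dec (proj₁ (lookup τ a) <? proj₁ (lookup τ b)))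
  ×-dec (((proj₁ (lookup τ a) <? proj₁ (lookup τ b)) →-dec (proj₁ (lookup u a) <? proj₁ (lookup u b)))
  ×-dec (proj₂ (lookup u a) ≟B proj₂ (lookup τ a)))

Contains : ∀ {n k} → Word n → Vec (Letter k) k → Set
Contains {n} {k} π τ = Any (Matches τ) (subseqs k π)

Avoids : ∀ {n k} → Word n → Vec (Letter k) k → Set
Avoids π τ = ¬ Contains π τ

avoids? : ∀ {n k} (π : Word n) (τ : Vec (Letter k) k) → Dec (Avoids π τ)
avoids? {k = k} π τ = ¬? (Any.any? (matches? τ) (subseqs k π))

allVecs : ∀ {A : Set} → List A → (m : ℕ) → List (Vec A m)
allVecs xs zero = [ [] ]
allVecs xs (suc m) = concatMap (λ x → map (x ∷_) (allVecs xs m)) xs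

allLetters : ∀ n → List (Letter n)
allLetters n = concatMap (λ i → (i , true) ∷ (i , false) ∷ []) (Data.List.allFin n)

B : ∀ n → List (Word n)
B n = filter isSignedPerm? (allVecs (allLetters n) n)

SI : ∀ n → List (Word n)
SI n = filter isInvolution? (B n)

avoiding : ∀ {n k} → List (Word n) → Vec (Letter k) k → List (Word n)
avoiding M τ = filter (λ π → avoids? π τ) M

incr : ∀ k → Vec (Letter k) k
incr k = tabulate (λ i → (i , true))

{-# OPTIONS --safe #-}
-- Read a word from right to left. For each letter let r be the length of the longest chain
-- strictly to its upper right (increasing positions and absolute values) whose signs are
-- those of the last r letters of τ, so that w contains τ iff such a chain has length k.
-- Make the letter positive if its sign is the one τ requires of a letter followed by r
-- further letters, and negative otherwise. This turns the τ-chains of w into the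
-- all-positive chains of the image, so w avoids τ iff its image avoids 12…k. Each decision
-- depends only on the image of the suffix already processed, so the map is a bijection on
-- words, and it keeps absolute values. For a signed involution, transposing the graph maps
-- the chains to the upper right of position i onto those of position |w_i|; both letters
-- get the same sign change, so the image is again an involution.
module Submission where

open import Defs
open import Data.Bool using (Bool; true; false; if_then_else_)
open import Data.Empty using (⊥)
open import Data.Fin as Fin using (Fin; zero; suc; toℕ)
import Data.Fin.Properties as Fin
open import Data.List using (List; []; _∷_; _++_; map; concatMap; filter; length; allFin)
open import Data.List.Properties using (map-++; map-∘; map-cong)
open import Data.List.Relation.Unary.Any as Any using (Any; here)
import Data.List.Relation.Unary.Any.Properties as Any
open import Data.Nat using (ℕ; zero; suc; _+_; _≤_; _<_; _≥_; _⊔_; _≤?_; _≟_; z≤n; s≤s; z<s; s≤s⁻¹)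
open import Data.Nat.ListAction using (sum)
open import Data.Nat.ListAction.Properties using (sum-++)
open import Data.Nat.Properties
  using (≤-refl; ≤-reflexive; ≤-trans; ≤-antisym; <⇒≤; <⇒≢; n≤1+n; m<n⇒m<1+n; m≤n⇒m<n∨m≡n;
         ⊔-sel; m≤m⊔n; m≤n⊔m; +-commutativeSemigroup)
open import Algebra.Properties.CommutativeSemigroup +-commutativeSemigroup using (interchange; x∙yz≈y∙xz)
open import Data.Product using (_×_; _,_; proj₁; proj₂; ∃-syntax)
open import Data.Product.Function.NonDependent.Propositional using (_×-⇔_)
open import Data.Sum using (_⊎_; inj₁; inj₂)
open import Data.Unit using (⊤; tt)
open import Data.Vec as Vec using (Vec; []; _∷_; lookup; tabulate)
open import Data.Vec.Properties using (lookup-map; tabulate-∘; lookup∘tabulate)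
open import Function using (_∘_; _⇔_; mk⇔; Equivalence)
open import Function.Properties.Equivalence using () renaming (trans to ⇔-trans; sym to ⇔-sym)
open import Function.Related.TypeIsomorphisms using (¬-cong-⇔)
open import Level using (Level)
open import Relation.Binary using (tri<; tri≈; tri>)
open import Relation.Binary.PropositionalEquality
open import Relation.Nullary using (yes; no; does; contradiction)
open import Relation.Nullary.Decidable using (does-⇔; dec-true; dec-false)
open import Relation.Unary using (Pred; Decidable)
open import Relation.Unary.Properties using (_∩?_)

private
  variable
    A : Set
    p q : Level
    n m j k lo lo′ : ℕ

∑ : (A → ℕ) → List A → ℕ
∑ f xs = sum (map f xs)

∑-cong : {f g : A → ℕ} → (∀ x → f x ≡ g x) → (xs : List A) → ∑ f xs ≡ ∑ g xs
∑-cong f≗g xs = cong sum (map-cong f≗g xs)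

∑-++ : (f : A → ℕ) (xs ys : List A) → ∑ f (xs ++ ys) ≡ ∑ f xs + ∑ f ys
∑-++ f xs ys = trans (cong sum (map-++ f xs ys)) (sum-++ (map f xs) (map f ys))

∑-map : {B : Set} (f : B → ℕ) (g : A → B) (xs : List A) → ∑ f (map g xs) ≡ ∑ (f ∘ g) xs
∑-map f g xs = cong sum (sym (map-∘ xs))

∑-concatMap : {B : Set} (f : B → ℕ) (g : A → List B) (xs : List A) →
  ∑ f (concatMap g xs) ≡ ∑ (λ x → ∑ f (g x)) xs
∑-concatMap f g []       = refl
∑-concatMap f g (x ∷ xs) = trans (∑-++ f (g x) (concatMap g xs)) (cong (∑ f (g x) +_) (∑-concatMap f g xs))

∑-zero : (xs : List A) → ∑ (λ _ → 0) xs ≡ 0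
∑-zero []       = refl
∑-zero (x ∷ xs) = ∑-zero xs

∑-+ : (f g : A → ℕ) (xs : List A) → ∑ (λ x → f x + g x) xs ≡ ∑ f xs + ∑ g xs
∑-+ f g []       = refl
∑-+ f g (x ∷ xs) = trans (cong (f x + g x +_) (∑-+ f g xs)) (interchange (f x) (g x) (∑ f xs) (∑ g xs))

∑-comm : {B : Set} (f : A → B → ℕ) (xs : List A) (ys : List B) →
  ∑ (λ x → ∑ (f x) ys) xs ≡ ∑ (λ y → ∑ (λ x → f x y) xs) ys
∑-comm f []       ys = sym (∑-zero ys)
∑-comm f (x ∷ xs) ys = trans (cong (∑ (f x) ys +_) (∑-comm f xs ys)) (sym (∑-+ (f x) _ ys))

triangular : (∀ {m} → Vec A m → A → A) → Vec A m → Vec A m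
triangular ψ []       = []
triangular ψ (x ∷ v)  = ψ (triangular ψ v) x ∷ triangular ψ v

indicator : {P : Pred A p} → Decidable P → A → ℕ
indicator P? x = if does (P? x) then 1 else 0

length-filter≡∑ : {P : Pred A p} (P? : Decidable P) (xs : List A) → length (filter P? xs) ≡ ∑ (indicator P?) xs
length-filter≡∑ P? []       = refl
length-filter≡∑ P? (x ∷ xs) with does (P? x)
... | true  = cong suc (length-filter≡∑ P? xs)
... | false = length-filter≡∑ P? xs

filter-filter : {P : Pred A p} {Q : Pred A q} (P? : Decidable P) (Q? : Decidable Q) (xs : List A) →
  filter Q? (filter P? xs) ≡ filter (P? ∩? Q?) xs
filter-filter P? Q? []       = refl
filter-filter P? Q? (x ∷ xs) with P? x
... | no _  = filter-filter P? Q? xs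
... | yes _ with Q? x
...   | yes _ = cong (x ∷_) (filter-filter P? Q? xs)
...   | no _  = filter-filter P? Q? xs

module _ (L : List A) (ψ : ∀ {m} → Vec A m → A → A)
         (ψ-permutes : ∀ {m} (v : Vec A m) (w : A → ℕ) → ∑ (w ∘ ψ v) L ≡ ∑ w L) where

  ∑-triangular : ∀ m (w : Vec A m → ℕ) → ∑ (w ∘ triangular ψ) (allVecs L m) ≡ ∑ w (allVecs L m)
  ∑-triangular zero    w = refl
  ∑-triangular (suc m) w = begin
      ∑ (w ∘ triangular ψ) (allVecs L (suc m))
    ≡⟨ ∑-concatMap _ _ L ⟩
      ∑ (λ x → ∑ (w ∘ triangular ψ) (map (x ∷_) V)) L
    ≡⟨ ∑-cong (λ x → ∑-map _ (x ∷_) V) L ⟩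
      ∑ (λ x → ∑ (λ v → w (ψ (triangular ψ v) x ∷ triangular ψ v)) V) L
    ≡⟨ ∑-comm _ L V ⟩
      ∑ (λ v → ∑ (λ x → w (ψ (triangular ψ v) x ∷ triangular ψ v)) L) V
    ≡⟨ ∑-triangular m (λ v → ∑ (λ x → w (ψ v x ∷ v)) L) ⟩
      ∑ (λ v → ∑ (λ x → w (ψ v x ∷ v)) L) V
    ≡⟨ ∑-cong (λ v → ψ-permutes v (λ x → w (x ∷ v))) V ⟩
      ∑ (λ v → ∑ (λ x → w (x ∷ v)) L) V
    ≡⟨ ∑-comm (λ x v → w (x ∷ v)) L V ⟨
      ∑ (λ x → ∑ (w ∘ (x ∷_)) V) L
    ≡⟨ ∑-cong (λ x → ∑-map w (x ∷_) V) L ⟨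
      ∑ (λ x → ∑ w (map (x ∷_) V)) L
    ≡⟨ ∑-concatMap _ _ L ⟨
      ∑ w (allVecs L (suc m)) ∎
    where
    open ≡-Reasoning
    V = allVecs L m

  length-filter-triangular : {P : Pred (Vec A m) p} {Q : Pred (Vec A m) q}
    (P? : Decidable P) (Q? : Decidable Q) → (∀ v → P v ⇔ Q (triangular ψ v)) →
    length (filter P? (allVecs L m)) ≡ length (filter Q? (allVecs L m))
  length-filter-triangular {m} P? Q? P⇔Q = begin
      length (filter P? V)              ≡⟨ length-filter≡∑ P? V ⟩
      ∑ (indicator P?) V                ≡⟨ ∑-cong (λ v → cong (if_then 1 else 0) (does-⇔ (P⇔Q v) (P? v) (Q? _))) V ⟩
      ∑ (indicator Q? ∘ triangular ψ) V ≡⟨ ∑-triangular m (indicator Q?) ⟩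
      ∑ (indicator Q?) V                ≡⟨ length-filter≡∑ Q? V ⟨
      length (filter Q? V)              ∎
    where
    open ≡-Reasoning
    V = allVecs L m

sgnMul-identityʳ : ∀ s → sgnMul s true ≡ s
sgnMul-identityʳ true  = refl
sgnMul-identityʳ false = refl

sgnMul-self : ∀ s → sgnMul s s ≡ true
sgnMul-self true  = refl
sgnMul-self false = refl

sgnMul-cancelʳ : ∀ s c → sgnMul (sgnMul s c) c ≡ s
sgnMul-cancelʳ true  c     = sgnMul-self c
sgnMul-cancelʳ false true  = refl
sgnMul-cancelʳ false false = refl

sgnMul-injectiveˡ : ∀ {s s′} c → sgnMul s c ≡ sgnMul s′ c → s ≡ s′
sgnMul-injectiveˡ {s} {s′} c eq =
  trans (sym (sgnMul-cancelʳ s c)) (trans (cong (λ t → sgnMul t c) eq) (sgnMul-cancelʳ s′ c))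

sgnMul≡true⇒≡ : ∀ {s c} → sgnMul s c ≡ true → s ≡ c
sgnMul≡true⇒≡ {s} {c} eq = trans (sym (sgnMul-cancelʳ s c)) (cong (λ t → sgnMul t c) eq)

absAt : Vec (Letter n) m → Fin m → Fin n
absAt v i = proj₁ (lookup v i)

signAt : Vec (Letter n) m → Fin m → Bool
signAt v i = proj₂ (lookup v i)

signs : Vec (Letter n) m → Vec Bool m
signs = Vec.map proj₂

-- δ m is the sign required of a pattern letter followed by m further letters, so
-- lastSigns δ j lists the signs of the last j letters of the pattern.
SignSeq : Set
SignSeq = ℕ → Bool

allPositive : SignSeq
allPositive _ = true

lastSigns : SignSeq → (j : ℕ) → Vec Bool j
lastSigns δ zero    = []
lastSigns δ (suc j) = δ j ∷ lastSigns δ j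

signSeq : Vec Bool j → SignSeq
signSeq []             m = true
signSeq (_∷_ {j} e ss) m = if does (m ≟ j) then e else signSeq ss m

lastSigns-cong : ∀ {δ δ′} j → (∀ {m} → m < j → δ m ≡ δ′ m) → lastSigns δ j ≡ lastSigns δ′ j
lastSigns-cong zero    _   = refl
lastSigns-cong (suc j) δ≗δ′ = cong₂ _∷_ (δ≗δ′ ≤-refl) (lastSigns-cong j (δ≗δ′ ∘ m<n⇒m<1+n))

lastSigns-signSeq : (ss : Vec Bool j) → lastSigns (signSeq ss) j ≡ ss
lastSigns-signSeq []             = refl
lastSigns-signSeq (_∷_ {j} e ss) = cong₂ _∷_
  (cong (if_then e else signSeq ss j) (dec-true (j ≟ j) refl))
  (trans (lastSigns-cong j (λ {m} m<j → cong (if_then e else signSeq ss m) (dec-false (m ≟ j) (<⇒≢ m<j))))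
         (lastSigns-signSeq ss))

lastSigns-allPositive : ∀ k → lastSigns allPositive k ≡ signs (incr k)
lastSigns-allPositive k = trans (all-true k) (tabulate-∘ proj₂ (λ i → i , true))
  where
  all-true : ∀ k → lastSigns allPositive k ≡ tabulate {n = k} (λ _ → true)
  all-true zero    = refl
  all-true (suc k) = cong (true ∷_) (all-true k)

Embeds : ℕ → Vec Bool j → Vec (Letter n) m → Set
Embeds lo []       v             = ⊤
Embeds lo (e ∷ ss) []            = ⊥
Embeds lo (e ∷ ss) ((a , s) ∷ v) =
  (lo ≤ toℕ a × s ≡ e × Embeds (suc (toℕ a)) ss v) ⊎ Embeds lo (e ∷ ss) v

Embeds-antitone : lo ≤ lo′ → (ss : Vec Bool j) (v : Vec (Letter n) m) → Embeds lo′ ss v → Embeds lo ss v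
Embeds-antitone lo≤lo′ []       v             _                        = tt
Embeds-antitone lo≤lo′ (e ∷ ss) ((a , s) ∷ v) (inj₁ (lo′≤a , s≡e , em)) = inj₁ (≤-trans lo≤lo′ lo′≤a , s≡e , em)
Embeds-antitone lo≤lo′ (e ∷ ss) ((a , s) ∷ v) (inj₂ em)                 = inj₂ (Embeds-antitone lo≤lo′ (e ∷ ss) v em)

extendIf : Bool → ℕ → ℕ
extendIf true  r = suc r
extendIf false r = r

grow : SignSeq → Bool → ℕ → ℕ
grow δ s r = extendIf (sgnMul s (δ r)) r

longest : SignSeq → ℕ → Vec (Letter n) m → ℕ
longest δ lo []            = 0
longest δ lo ((a , s) ∷ v) with lo ≤? toℕ a
... | yes _ = longest δ lo v ⊔ grow δ s (longest δ (suc (toℕ a)) v)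
... | no _  = longest δ lo v

≤-extendIf : ∀ b r → r ≤ extendIf b r
≤-extendIf true  r = n≤1+n r
≤-extendIf false r = ≤-refl

<-grow : ∀ δ {s j r} → j ≤ r → s ≡ δ j → j < grow δ s r
<-grow δ {s} {j} j≤r s≡δj with m≤n⇒m<n∨m≡n j≤r
... | inj₁ j<r  = ≤-trans j<r (≤-extendIf (sgnMul s (δ _)) _)
... | inj₂ refl rewrite s≡δj | sgnMul-self (δ j) = ≤-refl

<-grow-cases : ∀ δ {s j} r → j < grow δ s r → j < r ⊎ (r ≡ j × s ≡ δ r)
<-grow-cases δ {s} r j<g with sgnMul s (δ r) in eq
... | false = inj₁ j<g
... | true with m≤n⇒m<n∨m≡n (s≤s⁻¹ j<g)
...   | inj₁ j<r  = inj₁ j<r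
...   | inj₂ refl = inj₂ (refl , sgnMul≡true⇒≡ eq)

≤⊔-cases : ∀ {a b c} → a ≤ b ⊔ c → a ≤ b ⊎ a ≤ c
≤⊔-cases {a} {b} {c} a≤b⊔c with ⊔-sel b c
... | inj₁ eq = inj₁ (subst (a ≤_) eq a≤b⊔c)
... | inj₂ eq = inj₂ (subst (a ≤_) eq a≤b⊔c)

module _ (δ : SignSeq) where

  Embeds⇒≤longest : ∀ j (v : Vec (Letter n) m) → Embeds lo (lastSigns δ j) v → j ≤ longest δ lo v
  Embeds⇒≤longest zero    v             _ = z≤n
  Embeds⇒≤longest {lo = lo} (suc j) ((a , s) ∷ v) em with lo ≤? toℕ a | em
  ... | yes _     | inj₁ (_ , s≡δj , em′) = ≤-trans (<-grow δ (Embeds⇒≤longest j v em′) s≡δj) (m≤n⊔m _ _)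
  ... | yes _     | inj₂ em′ = ≤-trans (Embeds⇒≤longest (suc j) v em′) (m≤m⊔n _ _)
  ... | no lo≰a  | inj₁ (lo≤a , _) = contradiction lo≤a lo≰a
  ... | no _      | inj₂ em′ = Embeds⇒≤longest (suc j) v em′

  ≤longest⇒Embeds : ∀ j (v : Vec (Letter n) m) → j ≤ longest δ lo v → Embeds lo (lastSigns δ j) v
  ≤longest⇒Embeds zero    v             _ = tt
  ≤longest⇒Embeds {lo = lo} (suc j) ((a , s) ∷ v) j<l with lo ≤? toℕ a
  ... | no _ = inj₂ (≤longest⇒Embeds (suc j) v j<l)
  ... | yes lo≤a with ≤⊔-cases j<l
  ...   | inj₁ j<l′ = inj₂ (≤longest⇒Embeds (suc j) v j<l′)
  ...   | inj₂ j<g with <-grow-cases δ (longest δ (suc (toℕ a)) v) j<g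
  ...     | inj₁ j<r = inj₂ (Embeds-antitone (≤-trans lo≤a (n≤1+n _)) (lastSigns δ (suc j)) v (≤longest⇒Embeds (suc j) v j<r))
  ...     | inj₂ (r≡j , s≡δr) = inj₁ (lo≤a , trans s≡δr (cong δ r≡j) , ≤longest⇒Embeds j v (≤-reflexive (sym r≡j)))

  ≤longest⇔Embeds : ∀ {j} {v : Vec (Letter n) m} → j ≤ longest δ lo v ⇔ Embeds lo (lastSigns δ j) v
  ≤longest⇔Embeds {j = j} {v} = mk⇔ (≤longest⇒Embeds j v) (Embeds⇒≤longest j v)

flipBy : SignSeq → Vec (Letter n) m → Letter n → Letter n
flipBy δ v (a , s) = a , sgnMul s (δ (longest allPositive (suc (toℕ a)) v))

flipSigns : SignSeq → Vec (Letter n) m → Vec (Letter n) m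
flipSigns δ = triangular (flipBy δ)

longest-flipSigns : ∀ δ lo (v : Vec (Letter n) m) → longest allPositive lo (flipSigns δ v) ≡ longest δ lo v
longest-flipSigns δ lo []            = refl
longest-flipSigns δ lo ((a , s) ∷ v) with lo ≤? toℕ a
... | no _  = longest-flipSigns δ lo v
... | yes _ = cong₂ _⊔_ (longest-flipSigns δ lo v) (begin
    extendIf (sgnMul (sgnMul s (δ r′)) true) r′ ≡⟨ cong (λ b → extendIf b r′) (sgnMul-identityʳ _) ⟩
    grow δ s r′                                 ≡⟨ cong (grow δ s) (longest-flipSigns δ (suc (toℕ a)) v) ⟩
    grow δ s (longest δ (suc (toℕ a)) v)        ∎)
  where
  open ≡-Reasoning
  r′ = longest allPositive (suc (toℕ a)) (flipSigns δ v)

∑-allLetters-flip : (c : Fin n → Bool) (w : Letter n → ℕ) →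
  ∑ (λ (a , s) → w (a , sgnMul s (c a))) (allLetters n) ≡ ∑ w (allLetters n)
∑-allLetters-flip {n} c w = begin
    ∑ (λ (a , s) → w (a , sgnMul s (c a))) (allLetters n) ≡⟨ ∑-concatMap _ _ (allFin n) ⟩
    ∑ (λ a → w (a , c a) + (w (a , sgnMul false (c a)) + 0)) (allFin n) ≡⟨ ∑-cong (λ a → pair a (c a)) (allFin n) ⟩
    ∑ (λ a → w (a , true) + (w (a , false) + 0)) (allFin n) ≡⟨ ∑-concatMap _ _ (allFin n) ⟨
    ∑ w (allLetters n) ∎
  where
  open ≡-Reasoning
  pair : ∀ a b → w (a , b) + (w (a , sgnMul false b) + 0) ≡ w (a , true) + (w (a , false) + 0)
  pair a true  = refl
  pair a false = x∙yz≈y∙xz (w (a , false)) (w (a , true)) 0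

Chain : ℕ → Vec Bool j → Vec (Letter n) j → Set
Chain lo []       []            = ⊤
Chain lo (e ∷ ss) ((a , s) ∷ u) = lo ≤ toℕ a × s ≡ e × Chain (suc (toℕ a)) ss u

Any-Chain⇒Embeds : (ss : Vec Bool j) (v : Vec (Letter n) m) → Any (Chain lo ss) (subseqs j v) → Embeds lo ss v
Any-Chain⇒Embeds []       v             _ = tt
Any-Chain⇒Embeds (e ∷ ss) []            ()
Any-Chain⇒Embeds {j = suc j} (e ∷ ss) ((a , s) ∷ v) chains
  with Any.++⁻ (map ((a , s) ∷_) (subseqs j v)) chains
... | inj₂ later = inj₂ (Any-Chain⇒Embeds (e ∷ ss) v later)
... | inj₁ first =
  let starting = Any.map⁻ first
      _ , lo≤a , s≡e , _ = Any.satisfied starting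
  in inj₁ (lo≤a , s≡e , Any-Chain⇒Embeds ss v (Any.map (proj₂ ∘ proj₂) starting))

Embeds⇒Any-Chain : (ss : Vec Bool j) (v : Vec (Letter n) m) → Embeds lo ss v → Any (Chain lo ss) (subseqs j v)
Embeds⇒Any-Chain []       v             _ = here tt
Embeds⇒Any-Chain (e ∷ ss) ((a , s) ∷ v) (inj₁ (lo≤a , s≡e , em)) =
  Any.++⁺ˡ (Any.map⁺ (Any.map (λ ch → lo≤a , s≡e , ch) (Embeds⇒Any-Chain ss v em)))
Embeds⇒Any-Chain {j = suc j} (e ∷ ss) ((a , s) ∷ v) (inj₂ em) =
  Any.++⁺ʳ (map ((a , s) ∷_) (subseqs j v)) (Embeds⇒Any-Chain (e ∷ ss) v em)

Increasing : Vec (Letter n) m → Set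
Increasing u = ∀ i j → i Fin.< j → absAt u i Fin.< absAt u j

Increasing⇒reflects-< : {u : Vec (Letter n) m} → Increasing u → ∀ i j → absAt u i Fin.< absAt u j → i Fin.< j
Increasing⇒reflects-< inc i j ui<uj with Fin.<-cmp i j
... | tri< i<j _ _ = i<j
... | tri≈ _ refl _ = contradiction ui<uj (Fin.<-irrefl refl)
... | tri> _ _ j<i = contradiction ui<uj (Fin.<-asym (inc j i j<i))

Chain⇒Increasing : (ss : Vec Bool j) (u : Vec (Letter n) j) → Chain lo ss u →
  (∀ i → lo ≤ toℕ (absAt u i)) × Increasing u × (∀ i → signAt u i ≡ lookup ss i)
Chain⇒Increasing []       []            _ = (λ ()) , (λ ()) , (λ ())
Chain⇒Increasing {lo = lo} (e ∷ ss) ((a , s) ∷ u) (lo≤a , s≡e , ch) with Chain⇒Increasing ss u ch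
... | above , inc , sg = bound , inc′ , sg′
  where
  bound : ∀ i → lo ≤ toℕ (absAt ((a , s) ∷ u) i)
  bound zero    = lo≤a
  bound (suc i) = ≤-trans lo≤a (<⇒≤ (above i))
  inc′ : Increasing ((a , s) ∷ u)
  inc′ zero    (suc j) _         = above j
  inc′ (suc i) (suc j) (s≤s i<j) = inc i j i<j
  sg′ : ∀ i → signAt ((a , s) ∷ u) i ≡ lookup (e ∷ ss) i
  sg′ zero    = s≡e
  sg′ (suc i) = sg i

Increasing⇒Chain : (ss : Vec Bool j) (u : Vec (Letter n) j) →
  (∀ i → lo ≤ toℕ (absAt u i)) → Increasing u → (∀ i → signAt u i ≡ lookup ss i) → Chain lo ss u
Increasing⇒Chain []       []            _     _   _  = tt
Increasing⇒Chain (e ∷ ss) ((a , s) ∷ u) bound inc sg =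
  bound zero , sg zero ,
  Increasing⇒Chain ss u (λ i → inc zero (suc i) z<s) (λ i j i<j → inc (suc i) (suc j) (s≤s i<j)) (sg ∘ suc)

module _ {τ : Vec (Letter k) k} (|τ|≡id : ∀ i → absAt τ i ≡ i) where

  private
    τ-< : ∀ {i j} → i Fin.< j → absAt τ i Fin.< absAt τ j
    τ-< {i} {j} = subst₂ Fin._<_ (sym (|τ|≡id i)) (sym (|τ|≡id j))

    τ-<⁻ : ∀ {i j} → absAt τ i Fin.< absAt τ j → i Fin.< j
    τ-<⁻ {i} {j} = subst₂ Fin._<_ (|τ|≡id i) (|τ|≡id j)

  Matches⇔Chain : {u : Vec (Letter n) k} → Matches τ u ⇔ Chain 0 (signs τ) u
  Matches⇔Chain {u = u} = mk⇔
    (λ M → Increasing⇒Chain (signs τ) u (λ _ → z≤n) (λ i j i<j → proj₁ (proj₂ (M i j)) (τ-< i<j))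
                              (λ i → trans (proj₂ (proj₂ (M i i))) (sym (lookup-map i proj₂ τ))))
    (λ ch → let _ , inc , sg = Chain⇒Increasing (signs τ) u ch in λ i j →
       (λ ui<uj → τ-< (Increasing⇒reflects-< {u = u} inc i j ui<uj)) , (λ τi<τj → inc i j (τ-<⁻ τi<τj)) ,
       trans (sg i) (lookup-map i proj₂ τ))

  Contains⇔Embeds : {w : Word n} → Contains w τ ⇔ Embeds 0 (signs τ) w
  Contains⇔Embeds {w = w} = mk⇔
    (Any-Chain⇒Embeds (signs τ) w ∘ Any.map (Equivalence.to Matches⇔Chain))
    (Any.map (Equivalence.from Matches⇔Chain) ∘ Embeds⇒Any-Chain (signs τ) w)

  Contains⇔≤longest : ∀ {δ} → lastSigns δ k ≡ signs τ → {w : Word n} → Contains w τ ⇔ k ≤ longest δ 0 w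
  Contains⇔≤longest {δ = δ} eq {w} =
    ⇔-trans Contains⇔Embeds (subst (λ ss → Embeds 0 ss w ⇔ k ≤ longest δ 0 w) eq (⇔-sym (≤longest⇔Embeds δ)))

-- Index-based form of Embeds for chains strictly to the upper right of position p; unlike
-- Embeds, it can be transposed along the graph of an involution.
ChainAfter : Vec (Letter n) m → Vec Bool j → Fin m → Set
ChainAfter v []       p = ⊤
ChainAfter v (e ∷ ss) p =
  ∃[ q ] p Fin.< q × absAt v p Fin.< absAt v q × signAt v q ≡ e × ChainAfter v ss q

module _ {x : Letter n} {v : Vec (Letter n) m} where

  ChainAfter-suc⁺ : ∀ {p} (ss : Vec Bool j) → ChainAfter v ss p → ChainAfter (x ∷ v) ss (suc p)
  ChainAfter-suc⁺ []       _                           = tt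
  ChainAfter-suc⁺ (e ∷ ss) (q , p<q , vp<vq , sg , ch) = suc q , s≤s p<q , vp<vq , sg , ChainAfter-suc⁺ ss ch

  ChainAfter-suc⁻ : ∀ {p} (ss : Vec Bool j) → ChainAfter (x ∷ v) ss (suc p) → ChainAfter v ss p
  ChainAfter-suc⁻ []       _                                 = tt
  ChainAfter-suc⁻ (e ∷ ss) (suc q , s≤s p<q , vp<vq , sg , ch) = q , p<q , vp<vq , sg , ChainAfter-suc⁻ ss ch

mutual
  Embeds⇒ChainAfter-zero : ∀ {a s} (ss : Vec Bool j) (v : Vec (Letter n) m) →
    Embeds (suc (toℕ a)) ss v → ChainAfter ((a , s) ∷ v) ss zero
  Embeds⇒ChainAfter-zero []       v _  = tt
  Embeds⇒ChainAfter-zero (e ∷ ss) v em with Embeds⇒ChainStart ss v em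
  ... | q , a<vq , sg , ch = suc q , z<s , a<vq , sg , ChainAfter-suc⁺ ss ch

  Embeds⇒ChainStart : ∀ {e} (ss : Vec Bool j) (v : Vec (Letter n) m) → Embeds lo (e ∷ ss) v →
    ∃[ q ] lo ≤ toℕ (absAt v q) × signAt v q ≡ e × ChainAfter v ss q
  Embeds⇒ChainStart ss ((a , s) ∷ v) (inj₁ (lo≤a , s≡e , em)) = zero , lo≤a , s≡e , Embeds⇒ChainAfter-zero ss v em
  Embeds⇒ChainStart ss (x ∷ v) (inj₂ em) with Embeds⇒ChainStart ss v em
  ... | q , lo≤vq , sg , ch = suc q , lo≤vq , sg , ChainAfter-suc⁺ ss ch

mutual
  ChainAfter-zero⇒Embeds : ∀ {a s} (ss : Vec Bool j) (v : Vec (Letter n) m) →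
    ChainAfter ((a , s) ∷ v) ss zero → Embeds (suc (toℕ a)) ss v
  ChainAfter-zero⇒Embeds []       v _                             = tt
  ChainAfter-zero⇒Embeds (e ∷ ss) v (suc q , _ , a<vq , sg , ch) = ChainStart⇒Embeds ss v (q , a<vq , sg , ChainAfter-suc⁻ ss ch)

  ChainStart⇒Embeds : ∀ {e} (ss : Vec Bool j) (v : Vec (Letter n) m) →
    (∃[ q ] lo ≤ toℕ (absAt v q) × signAt v q ≡ e × ChainAfter v ss q) → Embeds lo (e ∷ ss) v
  ChainStart⇒Embeds ss (x ∷ v) (zero  , lo≤x , sg , ch) = inj₁ (lo≤x , sg , ChainAfter-zero⇒Embeds ss v ch)
  ChainStart⇒Embeds ss (x ∷ v) (suc q , lo≤vq , sg , ch) = inj₂ (ChainStart⇒Embeds ss v (q , lo≤vq , sg , ChainAfter-suc⁻ ss ch))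

longestAfter : SignSeq → Vec (Letter n) m → Fin m → ℕ
longestAfter δ ((a , s) ∷ v) zero    = longest δ (suc (toℕ a)) v
longestAfter δ (x ∷ v)       (suc p) = longestAfter δ v p

≤longestAfter⇔ChainAfter : ∀ δ (v : Vec (Letter n) m) p → j ≤ longestAfter δ v p ⇔ ChainAfter v (lastSigns δ j) p
≤longestAfter⇔ChainAfter δ ((a , s) ∷ v) zero    =
  ⇔-trans (≤longest⇔Embeds δ) (mk⇔ (Embeds⇒ChainAfter-zero _ v) (ChainAfter-zero⇒Embeds _ v))
≤longestAfter⇔ChainAfter δ (x ∷ v)       (suc p) =
  ⇔-trans (≤longestAfter⇔ChainAfter δ v p) (mk⇔ (ChainAfter-suc⁺ _) (ChainAfter-suc⁻ _))

Symmetric : (Fin n → Fin n) → (Fin n → Bool) → Set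
Symmetric σ s = ∀ i → σ (σ i) ≡ i × s (σ i) ≡ s i

Symmetric-cong : {σ σ′ : Fin n → Fin n} {s s′ : Fin n → Bool} → (∀ i → σ i ≡ σ′ i) → (∀ i → s i ≡ s′ i) →
  Symmetric σ s → Symmetric σ′ s′
Symmetric-cong {σ = σ} {σ′} {s} {s′} σ≗σ′ s≗s′ sym-σs i =
  trans (sym (σ≗σ′ (σ′ i))) (trans (cong σ (sym (σ≗σ′ i))) (proj₁ (sym-σs i))) ,
  trans (sym (s≗s′ (σ′ i))) (trans (cong s (sym (σ≗σ′ i))) (trans (proj₂ (sym-σs i)) (s≗s′ i)))

Symmetric-twist : {σ : Fin n → Fin n} {s : Fin n → Bool} (c : Fin n → Bool) → (∀ i → c (σ i) ≡ c i) →
  Symmetric σ (λ i → sgnMul (s i) (c i)) ⇔ Symmetric σ s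
Symmetric-twist {σ = σ} {s} c c∘σ≗c = mk⇔
  (λ sym-σs′ i → proj₁ (sym-σs′ i) ,
     sgnMul-injectiveˡ (c i) (trans (cong (sgnMul (s (σ i))) (sym (c∘σ≗c i))) (proj₂ (sym-σs′ i))))
  (λ sym-σs i → proj₁ (sym-σs i) , cong₂ sgnMul (proj₂ (sym-σs i)) (c∘σ≗c i))

IsSymmetric : Word n → Set
IsSymmetric w = Symmetric (absAt w) (signAt w)

IsInvolution⇔IsSymmetric : {w : Word n} → IsInvolution w ⇔ IsSymmetric w
IsInvolution⇔IsSymmetric = mk⇔
  (λ inv i → cong proj₁ (inv i true) , sym (sgnMul≡true⇒≡ (cong proj₂ (inv i true))))
  (λ sym-w i s → cong₂ _,_ (proj₁ (sym-w i))
     (trans (cong (sgnMul (sgnMul s _)) (proj₂ (sym-w i))) (sgnMul-cancelʳ s _)))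

ChainAfter-transpose : {w : Word n} → IsSymmetric w → (ss : Vec Bool j) → ∀ {p} →
  ChainAfter w ss p → ChainAfter w ss (absAt w p)
ChainAfter-transpose sym-w []       _ = tt
ChainAfter-transpose {w = w} sym-w (e ∷ ss) {p} (q , p<q , wp<wq , sg , ch) =
  absAt w q , wp<wq , subst₂ Fin._<_ (sym (proj₁ (sym-w p))) (sym (proj₁ (sym-w q))) p<q ,
  trans (proj₂ (sym-w q)) sg , ChainAfter-transpose sym-w ss ch

longestAfter-transpose : ∀ δ {w : Word n} → IsSymmetric w → ∀ p → longestAfter δ w (absAt w p) ≡ longestAfter δ w p
longestAfter-transpose δ {w} sym-w p =
  ≤-antisym (subst (longestAfter δ w (absAt w p) ≤_) (cong (longestAfter δ w) (proj₁ (sym-w p))) (≤-transpose (absAt w p)))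
            (≤-transpose p)
  where
  ≤-transpose : ∀ p → longestAfter δ w p ≤ longestAfter δ w (absAt w p)
  ≤-transpose p = Equivalence.from (≤longestAfter⇔ChainAfter δ w (absAt w p))
    (ChainAfter-transpose sym-w (lastSigns δ _) (Equivalence.to (≤longestAfter⇔ChainAfter δ w p) ≤-refl))

module _ (δ : SignSeq) where

  lookup-flipSigns : (v : Vec (Letter n) m) (i : Fin m) →
    lookup (flipSigns δ v) i ≡ (absAt v i , sgnMul (signAt v i) (δ (longestAfter δ v i)))
  lookup-flipSigns ((a , s) ∷ v) zero    = cong (λ r → a , sgnMul s (δ r)) (longest-flipSigns δ (suc (toℕ a)) v)
  lookup-flipSigns (x ∷ v)       (suc i) = lookup-flipSigns v i

  absAt-flipSigns : (v : Vec (Letter n) m) (i : Fin m) → absAt (flipSigns δ v) i ≡ absAt v i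
  absAt-flipSigns v i = cong proj₁ (lookup-flipSigns v i)

  longestAfter-flipSigns : (v : Vec (Letter n) m) (i : Fin m) →
    longestAfter allPositive (flipSigns δ v) i ≡ longestAfter δ v i
  longestAfter-flipSigns ((a , s) ∷ v) zero    = longest-flipSigns δ (suc (toℕ a)) v
  longestAfter-flipSigns (x ∷ v)       (suc i) = longestAfter-flipSigns v i

  IsSignedPerm-flipSigns : {w : Word n} → IsSignedPerm w ⇔ IsSignedPerm (flipSigns δ w)
  IsSignedPerm-flipSigns {w = w} = mk⇔
    (λ perm i j eq → perm i j (trans (sym (absAt-flipSigns w i)) (trans eq (absAt-flipSigns w j))))
    (λ perm i j eq → perm i j (trans (absAt-flipSigns w i) (trans eq (sym (absAt-flipSigns w j)))))

  IsSymmetric-flipSigns : {w : Word n} → IsSymmetric w ⇔ IsSymmetric (flipSigns δ w)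
  IsSymmetric-flipSigns {w = w} = mk⇔
    (λ sym-w → as-flipped (Equivalence.from (twist (cong δ ∘ longestAfter-transpose δ {w} sym-w)) sym-w))
    (λ sym-F → Equivalence.to (twist (cong δ ∘ longestAfter-transpose-flipped sym-F)) (as-twisted sym-F))
    where
    F = flipSigns δ w
    c : Fin _ → Bool
    c i = δ (longestAfter δ w i)
    twist = Symmetric-twist {σ = absAt w} {signAt w} c
    as-flipped = Symmetric-cong (sym ∘ absAt-flipSigns w) (λ i → sym (cong proj₂ (lookup-flipSigns w i)))
    as-twisted = Symmetric-cong (absAt-flipSigns w) (λ i → cong proj₂ (lookup-flipSigns w i))
    longestAfter-transpose-flipped : IsSymmetric F → ∀ i → longestAfter δ w (absAt w i) ≡ longestAfter δ w i
    longestAfter-transpose-flipped sym-F i = begin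
      longestAfter δ w (absAt w i)                ≡⟨ longestAfter-flipSigns w (absAt w i) ⟨
      longestAfter allPositive F (absAt w i)      ≡⟨ cong (longestAfter allPositive F) (absAt-flipSigns w i) ⟨
      longestAfter allPositive F (absAt F i)      ≡⟨ longestAfter-transpose allPositive {F} sym-F i ⟩
      longestAfter allPositive F i                ≡⟨ longestAfter-flipSigns w i ⟩
      longestAfter δ w i                          ∎
      where open ≡-Reasoning

  IsInvolution-flipSigns : {w : Word n} → IsInvolution w ⇔ IsInvolution (flipSigns δ w)
  IsInvolution-flipSigns {w = w} =
    ⇔-trans (IsInvolution⇔IsSymmetric {w = w})
      (⇔-trans (IsSymmetric-flipSigns {w = w}) (⇔-sym (IsInvolution⇔IsSymmetric {w = flipSigns δ w})))

Avoids-flipSigns : (τ : Vec (Letter k) k) → (∀ i → absAt τ i ≡ i) → {w : Word n} →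
  Avoids w τ ⇔ Avoids (flipSigns (signSeq (signs τ)) w) (incr k)
Avoids-flipSigns {k} τ |τ|≡id {w} = ¬-cong-⇔ (⇔-trans
  (Contains⇔≤longest |τ|≡id (lastSigns-signSeq (signs τ)))
  (subst (λ l → k ≤ l ⇔ Contains (flipSigns δ w) (incr k)) (longest-flipSigns δ 0 w)
         (⇔-sym (Contains⇔≤longest |incr|≡id (lastSigns-allPositive k)))))
  where
  δ = signSeq (signs τ)
  |incr|≡id : ∀ i → absAt (incr k) i ≡ i
  |incr|≡id i = cong proj₁ (lookup∘tabulate (λ i → i , true) i)

module _ (δ : SignSeq) (τ τ′ : Vec (Letter k) k)
         (avoids⇔ : ∀ {n} {w : Word n} → Avoids w τ ⇔ Avoids (flipSigns δ w) τ′) where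

  private
    length-filter-flipSigns : ∀ {p q} {P : Pred (Word n) p} {Q : Pred (Word n) q}
      (P? : Decidable P) (Q? : Decidable Q) → (∀ w → P w ⇔ Q (flipSigns δ w)) →
      length (filter P? (allVecs (allLetters n) n)) ≡ length (filter Q? (allVecs (allLetters n) n))
    length-filter-flipSigns {n} =
      length-filter-triangular (allLetters n) (flipBy δ) (λ v w → ∑-allLetters-flip _ w)

    avoiding? : (σ : Vec (Letter k) k) → Decidable (λ (w : Word n) → Avoids w σ)
    avoiding? σ w = avoids? w σ

  length-avoiding-B : ∀ n → length (avoiding (B n) τ) ≡ length (avoiding (B n) τ′)
  length-avoiding-B n = begin
    length (avoiding (B n) τ)                         ≡⟨ cong length (filter-filter isSignedPerm? (avoiding? τ) V) ⟩
    length (filter (isSignedPerm? ∩? avoiding? τ) V)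
      ≡⟨ length-filter-flipSigns {n = n} (isSignedPerm? ∩? avoiding? τ) (isSignedPerm? ∩? avoiding? τ′)
           (λ w → IsSignedPerm-flipSigns δ {w = w} ×-⇔ avoids⇔) ⟩
    length (filter (isSignedPerm? ∩? avoiding? τ′) V) ≡⟨ cong length (filter-filter isSignedPerm? (avoiding? τ′) V) ⟨
    length (avoiding (B n) τ′)                        ∎
    where
    open ≡-Reasoning
    V = allVecs (allLetters n) n

  length-avoiding-SI : ∀ n → length (avoiding (SI n) τ) ≡ length (avoiding (SI n) τ′)
  length-avoiding-SI n = begin
    length (avoiding (SI n) τ)                       ≡⟨ cong length (avoiding-SI τ) ⟩
    length (filter (signedInvolution? ∩? avoiding? τ) V)
      ≡⟨ length-filter-flipSigns {n = n} (signedInvolution? ∩? avoiding? τ) (signedInvolution? ∩? avoiding? τ′)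
           (λ w → (IsSignedPerm-flipSigns δ {w = w} ×-⇔ IsInvolution-flipSigns δ {w = w}) ×-⇔ avoids⇔) ⟩
    length (filter (signedInvolution? ∩? avoiding? τ′) V) ≡⟨ cong length (avoiding-SI τ′) ⟨
    length (avoiding (SI n) τ′)                      ∎
    where
    open ≡-Reasoning
    V = allVecs (allLetters n) n
    signedInvolution? = isSignedPerm? ∩? isInvolution?
    avoiding-SI : ∀ σ → avoiding (SI n) σ ≡ filter (signedInvolution? ∩? avoiding? σ) V
    avoiding-SI σ = trans (cong (filter (avoiding? σ)) (filter-filter isSignedPerm? isInvolution? V))
                          (filter-filter signedInvolution? (avoiding? σ) V)

corollary2p2 : (k : ℕ) (τ : Vec (Letter k) k) →
    ((i : Fin k) → proj₁ (lookup τ i) ≡ i) →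
    (n : ℕ) → n ≥ 1 →
    (length (avoiding (B n) τ) ≡ length (avoiding (B n) (incr k)))
    × (length (avoiding (SI n) τ) ≡ length (avoiding (SI n) (incr k)))
corollary2p2 k τ |τ|≡id n _ = length-avoiding-B δ τ (incr k) avoids⇔ n , length-avoiding-SI δ τ (incr k) avoids⇔ n
  where
  δ = signSeq (signs τ)
  avoids⇔ : ∀ {n} {w : Word n} → Avoids w τ ⇔ Avoids (flipSigns δ w) (incr k)
  avoids⇔ = Avoids-flipSigns τ |τ|≡id
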